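{- Let $s,t$ be positive integers and let $F$ be a gerechte framework of order $n = st$ in which every region is an $s \times t$ rectangle. Then $F$ is realizable.
   Context: A gerechte framework of order $n$ is a partition of the cells of an $n\times n$ array into $n$ regions, each containing $n$ cells. A latin square of order $n$ is an $n\times n$ array with symbols $1,\dots,n$ in which each symbol appears exactly once in each row and once in each column. A latin square realizes a gerechte framework if, when its cells are partitioned by the framework, each region contains each symbol exactly once; a framework with such a latin square is called realizable. A region is an $a\times b$ rectangle if it consists of the cells lying in some $a$ consecutive rows and some $b$ consecutive columns (height $a$, width $b$). -}

module Defs where

open import Data.Nat using (ℕ; _*_; _+_; _≤_; _<_)
open import Data.Fin using (Fin; toℕ)
open import Data.Product using (Σ; _×_; _,_; ∃; ∃-syntax)
open import Relation.Binary.PropositionalEquality using (_≡_)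
open import Function.Bundles using (_↔_; _⇔_)

-- A cell of an n×n array: (row , column).
Cell : ℕ → Set
Cell n = Fin n × Fin n

∃! : {A : Set} → (A → Set) → Set
∃! {A} P = Σ A λ x → P x × (∀ y → P y → y ≡ x)

RegionCells : {n : ℕ} → (Cell n → Fin n) → Fin n → Set
RegionCells {n} reg r = Σ (Cell n) λ c → reg c ≡ r

record GerechteFramework (n : ℕ) : Set where
  field
    region : Cell n → Fin n
    regionSize : ∀ (r : Fin n) → Fin n ↔ RegionCells region r

open GerechteFramework public

IsRectangle : {n : ℕ} → GerechteFramework n → Fin n → ℕ → ℕ → Set
IsRectangle {n} F r a b =
  ∃[ i₀ ] ∃[ j₀ ] (∀ (i j : Fin n) →
    (region F (i , j) ≡ r) ⇔
      ((i₀ ≤ toℕ i × toℕ i < i₀ + a) × (j₀ ≤ toℕ j × toℕ j < j₀ + b)))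

-- A latin square of order n with symbols Fin n (standing for 1..n).
record LatinSquare (n : ℕ) : Set where
  field
    entry : Cell n → Fin n
    rowLatin : ∀ (i k : Fin n) → ∃! λ j → entry (i , j) ≡ k
    colLatin : ∀ (j k : Fin n) → ∃! λ i → entry (i , j) ≡ k

open LatinSquare public

Realizes : {n : ℕ} → LatinSquare n → GerechteFramework n → Set
Realizes {n} L F = ∀ (r k : Fin n) →
  ∃! λ (c : RegionCells (region F) r) → entry L (Data.Product.proj₁ c) ≡ k

Realizable : {n : ℕ} → GerechteFramework n → Set
Realizable {n} F = Σ (LatinSquare n) λ L → Realizes L F

-- A region that starts at column k + 1 meets, in its top row, the region containing the cell
-- at column k; that region must end exactly at column k, so by induction every region starts
-- at a multiple of t, and symmetrically at a row that is a multiple of s. Hence the regions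
-- are the blocks of the standard s × t grid. Writing row i = s a + b and column j = t c + d,
-- put the symbol t ((b + c) mod s) + ((a + d) mod t) in cell (i , j): along a row, a column
-- or a block, the map to the two symbol coordinates is a pair of cyclic translations.

module Submission where

open import Defs
open import Axiom.UniquenessOfIdentityProofs using (module Decidable⇒UIP)
open import Data.Nat using (ℕ; zero; suc; _+_; _*_; _∸_; _/_; _%_; _≤_; _<_; NonZero; s≤s; s≤s⁻¹; >-nonZero⁻¹)
open import Data.Nat.Properties
open import Data.Nat.DivMod
open import Data.Nat.Divisibility using (_∣_; _∣0; ∣m∣n⇒∣m+n; ∣-refl; divides-refl)
open import Data.Nat.Induction using (<-rec)
open import Data.Fin as Fin using (Fin; toℕ; fromℕ<; cast; combine; remQuot; quotient)
open import Data.Fin.Properties using (toℕ<n; toℕ-fromℕ<; toℕ-injective; toℕ-combine; combine-remQuot; *↔×; cast-involutive; toℕ-cast)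
open import Data.Product using (∃-syntax; _×_; _,_; proj₁; proj₂; swap)
open import Data.Product.Algebra using (×-comm)
open import Data.Product.Function.NonDependent.Propositional using (_×-↔_; _×-⇔_)
open import Data.Sum using (_⊎_; inj₁; inj₂)
open import Function using (flip)
open import Function.Bundles using (Inverse; _↔_; _⇔_; mk⇔; mk↔ₛ′; Equivalence)
open import Function.Construct.Composition using (_↔-∘_; _⇔-∘_)
open import Function.Construct.Symmetry using (↔-sym)
open import Relation.Binary.PropositionalEquality
open import Relation.Nullary using (contradiction)

open Inverse using (to; from)

↔⇒∃! : {A B : Set} (e : A ↔ B) {f : A → B} → (∀ a → f a ≡ to e a) → ∀ b → ∃! λ a → f a ≡ b
↔⇒∃! e {f} f≗to b =
  from e b ,
  trans (f≗to (from e b)) (Inverse.strictlyInverseˡ e b) ,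
  λ a fa≡b → trans (sym (Inverse.strictlyInverseʳ e a)) (cong (from e) (trans (sym (f≗to a)) fa≡b))

cast↔ : ∀ {m n} → m ≡ n → Fin m ↔ Fin n
cast↔ m≡n = mk↔ₛ′ (cast m≡n) (cast (sym m≡n)) (cast-involutive m≡n (sym m≡n)) (cast-involutive (sym m≡n) m≡n)

module _ {m : ℕ} .{{_ : NonZero m}} where

  private
    [a%m+b]%m≡[a+b]%m : ∀ a b → (a % m + b) % m ≡ (a + b) % m
    [a%m+b]%m≡[a+b]%m a b = begin
      (a % m + b) % m          ≡⟨ %-distribˡ-+ (a % m) b m ⟩
      (a % m % m + b % m) % m  ≡⟨ cong (λ u → (u + b % m) % m) (m%n%n≡m%n a m) ⟩
      (a % m + b % m) % m      ≡⟨ %-distribˡ-+ a b m ⟨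
      (a + b) % m              ∎
      where open ≡-Reasoning

    [a+m]%m≡a : ∀ {a} → a < m → (a + m) % m ≡ a
    [a+m]%m≡a {a} a<m = trans ([m+n]%n≡m%n a m) (m<n⇒m%n≡m a<m)

    toℕ-mod : ∀ a → toℕ (a mod m) ≡ a % m
    toℕ-mod a = toℕ-fromℕ< (m%n<n a m)

  infixl 6 _⊕_ _⊖_

  _⊕_ : Fin m → Fin m → Fin m
  x ⊕ y = (toℕ x + toℕ y) mod m

  -- m ∸ y stands for -y modulo m, avoiding the truncated subtraction x ∸ y.
  _⊖_ : Fin m → Fin m → Fin m
  x ⊖ y = (toℕ x + (m ∸ toℕ y)) mod m

  ⊕-comm : ∀ x y → x ⊕ y ≡ y ⊕ x
  ⊕-comm x y = cong (_mod m) (+-comm (toℕ x) (toℕ y))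

  ⊕-⊖-cancel : ∀ x y → x ⊕ y ⊖ y ≡ x
  ⊕-⊖-cancel x y = toℕ-injective (begin
    toℕ (x ⊕ y ⊖ y)                       ≡⟨ toℕ-mod _ ⟩
    (toℕ (x ⊕ y) + (m ∸ toℕ y)) % m        ≡⟨ cong (λ u → (u + (m ∸ toℕ y)) % m) (toℕ-mod _) ⟩
    ((toℕ x + toℕ y) % m + (m ∸ toℕ y)) % m ≡⟨ [a%m+b]%m≡[a+b]%m _ _ ⟩
    (toℕ x + toℕ y + (m ∸ toℕ y)) % m       ≡⟨ cong (_% m) (+-assoc (toℕ x) _ _) ⟩
    (toℕ x + (toℕ y + (m ∸ toℕ y))) % m     ≡⟨ cong (λ u → (toℕ x + u) % m) (m+[n∸m]≡n (<⇒≤ (toℕ<n y))) ⟩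
    (toℕ x + m) % m                         ≡⟨ [a+m]%m≡a (toℕ<n x) ⟩
    toℕ x                                   ∎)
    where open ≡-Reasoning

  ⊖-⊕-cancel : ∀ x y → x ⊖ y ⊕ y ≡ x
  ⊖-⊕-cancel x y = toℕ-injective (begin
    toℕ (x ⊖ y ⊕ y)                         ≡⟨ toℕ-mod _ ⟩
    (toℕ (x ⊖ y) + toℕ y) % m                 ≡⟨ cong (λ u → (u + toℕ y) % m) (toℕ-mod _) ⟩
    ((toℕ x + (m ∸ toℕ y)) % m + toℕ y) % m   ≡⟨ [a%m+b]%m≡[a+b]%m _ _ ⟩
    (toℕ x + (m ∸ toℕ y) + toℕ y) % m         ≡⟨ cong (_% m) (+-assoc (toℕ x) _ _) ⟩
    (toℕ x + (m ∸ toℕ y + toℕ y)) % m         ≡⟨ cong (λ u → (toℕ x + u) % m) (m∸n+n≡m (<⇒≤ (toℕ<n y))) ⟩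
    (toℕ x + m) % m                           ≡⟨ [a+m]%m≡a (toℕ<n x) ⟩
    toℕ x                                     ∎)
    where open ≡-Reasoning

  ⊕ʳ-↔ : Fin m → Fin m ↔ Fin m
  ⊕ʳ-↔ y = mk↔ₛ′ (_⊕ y) (_⊖ y) (λ x → ⊖-⊕-cancel x y) (λ x → ⊕-⊖-cancel x y)

  ⊕ˡ-↔ : Fin m → Fin m ↔ Fin m
  ⊕ˡ-↔ y = mk↔ₛ′ (y ⊕_) (_⊖ y)
    (λ x → trans (⊕-comm y (x ⊖ y)) (⊖-⊕-cancel x y))
    (λ x → trans (cong (_⊖ y) (⊕-comm y x)) (⊕-⊖-cancel x y))

[n*q+r]/n≡q : ∀ {n} .{{_ : NonZero n}} q {r} → r < n → (n * q + r) / n ≡ q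
[n*q+r]/n≡q {n} q {r} r<n = begin
  (n * q + r) / n      ≡⟨ cong (_/ n) (trans (+-comm (n * q) r) (cong (r +_) (*-comm n q))) ⟩
  (r + q * n) / n      ≡⟨ +-distrib-/-∣ʳ r (divides-refl q) ⟩
  r / n + q * n / n    ≡⟨ cong₂ _+_ (m<n⇒m/n≡0 r<n) (m*n/n≡m q n) ⟩
  q                    ∎
  where open ≡-Reasoning

toℕ-quotient : ∀ {m} n .{{_ : NonZero n}} (i : Fin (m * n)) → toℕ (quotient {m} n i) ≡ toℕ i / n
toℕ-quotient {m} n i = sym (begin
  toℕ i / n                    ≡⟨ cong (λ k → toℕ k / n) (combine-remQuot {m} n i) ⟨
  toℕ (combine q r) / n        ≡⟨ cong (_/ n) (toℕ-combine q r) ⟩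
  (n * toℕ q + toℕ r) / n      ≡⟨ [n*q+r]/n≡q (toℕ q) (toℕ<n r) ⟩
  toℕ q                        ∎)
  where
  open ≡-Reasoning
  q = proj₁ (remQuot {m} n i)
  r = proj₂ (remQuot {m} n i)

≡-via-toℕ : ∀ {A : Set} {k} (f : A → Fin k) {g : A → ℕ} → (∀ a → toℕ (f a) ≡ g a) →
            ∀ a a′ → g a ≡ g a′ ⇔ f a ≡ f a′
≡-via-toℕ f {g} toℕ-f a a′ = mk⇔
  (λ e → toℕ-injective (trans (toℕ-f a) (trans e (sym (toℕ-f a′)))))
  (λ e → trans (sym (toℕ-f a)) (trans (cong toℕ e) (toℕ-f a′)))

InRange : ℕ → ℕ → ℕ → Set
InRange lo len x = lo ≤ x × x < lo + len

InRange-*⇔/ : ∀ {q} .{{_ : NonZero q}} c x → InRange (c * q) q x ⇔ (x / q ≡ c)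
InRange-*⇔/ {q} c x = mk⇔ to′ from′
  where
  to′ : InRange (c * q) q x → x / q ≡ c
  to′ (cq≤x , x<cq+q) = ≤-antisym
    (s≤s⁻¹ (m<n*o⇒m/o<n (subst (x <_) (+-comm (c * q) q) x<cq+q)))
    (subst (_≤ x / q) (m*n/n≡m c q) (/-monoˡ-≤ q cq≤x))
  from′ : x / q ≡ c → InRange (c * q) q x
  from′ refl = m/n*n≤m x q , (begin-strict
    x                      ≡⟨ m≡m%n+[m/n]*n x q ⟩
    x % q + x / q * q      <⟨ +-monoˡ-< (x / q * q) (m%n<n x q) ⟩
    q + x / q * q          ≡⟨ +-comm q _ ⟩
    x / q * q + q          ∎)
    where open ≤-Reasoning

InRange⇔/ : ∀ {q lo} .{{_ : NonZero q}} x → q ∣ lo → InRange lo q x ⇔ (x / q ≡ lo / q)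
InRange⇔/ {q} {lo} x q∣lo = subst (λ l → InRange l q x ⇔ (x / q ≡ lo / q)) (m/n*n≡m q∣lo) (InRange-*⇔/ (lo / q) x)

RectangularTiling : {m n : ℕ} {R : Set} → (Fin m → Fin n → R) → (top left : R → ℕ) → (p q : ℕ) → Set
RectangularTiling region top left p q =
  ∀ r x y → region x y ≡ r ⇔ (InRange (top r) p (toℕ x) × InRange (left r) q (toℕ y))

transpose : {m n : ℕ} {R : Set} {region : Fin m → Fin n → R} {top left : R → ℕ} {p q : ℕ} →
            RectangularTiling region top left p q → RectangularTiling (flip region) left top q p
transpose tiling r y x = mk⇔ (λ e → swap (Equivalence.to (tiling r x y) e)) (λ h → Equivalence.from (tiling r x y) (swap h))

module _ {m n : ℕ} {R : Set} {region : Fin m → Fin n → R} {top left : R → ℕ} {p q : ℕ}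
         .{{_ : NonZero p}} .{{_ : NonZero q}} (tiling : RectangularTiling region top left p q) where

  private
    at : ∀ {a b} → a < m → b < n → R
    at a<m b<n = region (fromℕ< a<m) (fromℕ< b<n)

    at-∈ : ∀ {a b} (a<m : a < m) (b<n : b < n) r → at a<m b<n ≡ r ⇔ (InRange (top r) p a × InRange (left r) q b)
    at-∈ a<m b<n r = subst₂ (λ u v → at a<m b<n ≡ r ⇔ (InRange (top r) p u × InRange (left r) q v))
      (toℕ-fromℕ< a<m) (toℕ-fromℕ< b<n) (tiling r _ _)

  -- The cell (top r , k) just left of the corner of r lies in a region r′; if r′ reached
  -- column k + 1 it would share the cell (top r , k + 1) with r, forcing r′ = r.
  left-neighbour : ∀ x y {k} → left (region x y) ≡ suc k →
                   ∃[ x′ ] ∃[ y′ ] left (region x y) ≡ left (region x′ y′) + q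
  left-neighbour x y {k} left-r≡1+k = _ , _ , trans left-r≡1+k (reaches (m≤n⇒m<n∨m≡n k<left′+q))
    where
    r = region x y
    r∋x,y = Equivalence.to (tiling r x y) refl
    top<m : top r < m
    top<m = ≤-<-trans (proj₁ (proj₁ r∋x,y)) (toℕ<n x)
    1+k<n : suc k < n
    1+k<n = ≤-<-trans (subst (_≤ toℕ y) left-r≡1+k (proj₁ (proj₂ r∋x,y))) (toℕ<n y)
    k<n : k < n
    k<n = <-trans (n<1+n k) 1+k<n
    r′ = at top<m k<n
    r′∋top,k = Equivalence.to (at-∈ top<m k<n r′) refl
    left′≤k : left r′ ≤ k
    left′≤k = proj₁ (proj₂ r′∋top,k)
    k<left′+q : k < left r′ + q
    k<left′+q = proj₂ (proj₂ r′∋top,k)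
    reaches : suc k < left r′ + q ⊎ suc k ≡ left r′ + q → suc k ≡ left r′ + q
    reaches (inj₂ 1+k≡left′+q) = 1+k≡left′+q
    reaches (inj₁ 1+k<left′+q) = contradiction (subst (_≤ k) left-r≡1+k left-r≤k) (n≮n k)
      where
      next-in-r : at top<m 1+k<n ≡ r
      next-in-r = Equivalence.from (at-∈ top<m 1+k<n r)
        ( (≤-refl , m<m+n (top r) (>-nonZero⁻¹ p))
        , subst (λ l → InRange l q (suc k)) (sym left-r≡1+k) (≤-refl , m<m+n (suc k) (>-nonZero⁻¹ q)))
      next-in-r′ : at top<m 1+k<n ≡ r′
      next-in-r′ = Equivalence.from (at-∈ top<m 1+k<n r′) (proj₁ r′∋top,k , (≤-trans left′≤k (n≤1+n k) , 1+k<left′+q))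
      left-r≤k : left r ≤ k
      left-r≤k = proj₁ (proj₂ (Equivalence.to (at-∈ top<m k<n r) (trans (sym next-in-r′) next-in-r)))

  left-aligned : ∀ x y → q ∣ left (region x y)
  left-aligned x y = <-rec P aligned (left (region x y)) x y refl
    where
    P : ℕ → Set
    P k = ∀ x y → left (region x y) ≡ k → q ∣ k

    aligned : ∀ k → (∀ {j} → j < k → P j) → P k
    aligned zero    _  _ _ _ = q ∣0
    aligned (suc k) ih x y left-r≡1+k with x′ , y′ , left-r≡left′+q ← left-neighbour x y left-r≡1+k =
      subst (q ∣_) eq (∣m∣n⇒∣m+n (ih left′<1+k x′ y′ refl) ∣-refl)
      where
      left′ = left (region x′ y′)
      eq : left′ + q ≡ suc k
      eq = trans (sym left-r≡left′+q) left-r≡1+k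
      left′<1+k : left′ < suc k
      left′<1+k = subst (left′ <_) eq (m<m+n left′ (>-nonZero⁻¹ q))

module _ {m n : ℕ} {R : Set} {region : Fin m → Fin n → R} {top left : R → ℕ} {p q : ℕ}
         .{{_ : NonZero p}} .{{_ : NonZero q}} (tiling : RectangularTiling region top left p q) where

  top-aligned : ∀ x y → p ∣ top (region x y)
  top-aligned x y = left-aligned (transpose tiling) y x

  sameRegion⇔sameBlock :
    ∀ x y x′ y′ → region x y ≡ region x′ y′ ⇔ (toℕ x / p ≡ toℕ x′ / p × toℕ y / q ≡ toℕ y′ / q)
  sameRegion⇔sameBlock x y x′ y′ = mk⇔
    (λ e → let (x≈ , y≈) = Equivalence.to (inBlock x y) e in trans x≈ (sym x′≈) , trans y≈ (sym y′≈))
    (λ { (x≈ , y≈) → Equivalence.from (inBlock x y) (trans x≈ x′≈ , trans y≈ y′≈) })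
    where
    r = region x′ y′
    inBlock : ∀ x y → region x y ≡ r ⇔ (toℕ x / p ≡ top r / p × toℕ y / q ≡ left r / q)
    inBlock x y = (InRange⇔/ (toℕ x) (top-aligned x′ y′) ×-⇔ InRange⇔/ (toℕ y) (left-aligned tiling x′ y′))
                  ⇔-∘ tiling r x y
    x′≈ = proj₁ (Equivalence.to (inBlock x′ y′) refl)
    y′≈ = proj₂ (Equivalence.to (inBlock x′ y′) refl)

regionCells↔ : ∀ {n} {X Y Z W : Set} (reg : Cell n → Fin n) (r : Fin n)
  (rows : Fin n ↔ (X × Y)) (columns : Fin n ↔ (Z × W)) (x : X) (z : Z) →
  (∀ i j → reg (i , j) ≡ r ⇔ (proj₁ (to rows i) ≡ x × proj₁ (to columns j) ≡ z)) →
  RegionCells reg r ↔ (Y × W)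
regionCells↔ {n} {Y = Y} {W = W} reg r rows columns x z inRegion = mk↔ₛ′ offsets cellAt offsets-cellAt cellAt-offsets
  where
  open Inverse using (strictlyInverseˡ; strictlyInverseʳ)

  offsets : RegionCells reg r → Y × W
  offsets ((i , j) , _) = proj₂ (to rows i) , proj₂ (to columns j)

  cellAt : Y × W → RegionCells reg r
  cellAt (y , w) = (from rows (x , y) , from columns (z , w)) ,
    Equivalence.from (inRegion _ _) (cong proj₁ (strictlyInverseˡ rows (x , y)) , cong proj₁ (strictlyInverseˡ columns (z , w)))

  offsets-cellAt : ∀ yw → offsets (cellAt yw) ≡ yw
  offsets-cellAt (y , w) = cong₂ _,_ (cong proj₂ (strictlyInverseˡ rows (x , y))) (cong proj₂ (strictlyInverseˡ columns (z , w)))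

  cell-≡ : ∀ {c c′ : Cell n} {e : reg c ≡ r} {e′ : reg c′ ≡ r} → c ≡ c′ → (c , e) ≡ (c′ , e′)
  cell-≡ refl = cong (_ ,_) (Decidable⇒UIP.≡-irrelevant Fin._≟_ _ _)

  cellAt-offsets : ∀ c → cellAt (offsets c) ≡ c
  cellAt-offsets ((i , j) , e) = cell-≡ (cong₂ _,_
    (trans (cong (λ a → from rows (a , _)) (sym (proj₁ blocks))) (strictlyInverseʳ rows i))
    (trans (cong (λ a → from columns (a , _)) (sym (proj₂ blocks))) (strictlyInverseʳ columns j)))
    where blocks = Equivalence.to (inRegion i j) e

module BlockLatinSquare (s t : ℕ) .{{_ : NonZero s}} .{{_ : NonZero t}} where

  -- Row i = s · band i + rowOffset i and column j = t · stack j + columnOffset j;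
  -- symbols are coordinatised like columns.
  rows : Fin (s * t) ↔ (Fin t × Fin s)
  rows = *↔× ↔-∘ cast↔ (*-comm s t)

  columns : Fin (s * t) ↔ (Fin s × Fin t)
  columns = *↔×

  band : Fin (s * t) → Fin t
  band i = proj₁ (to rows i)

  rowOffset : Fin (s * t) → Fin s
  rowOffset i = proj₂ (to rows i)

  stack : Fin (s * t) → Fin s
  stack j = proj₁ (to columns j)

  columnOffset : Fin (s * t) → Fin t
  columnOffset j = proj₂ (to columns j)

  toℕ-band : ∀ i → toℕ (band i) ≡ toℕ i / s
  toℕ-band i = trans (toℕ-quotient s (cast (*-comm s t) i)) (cong (_/ s) (toℕ-cast (*-comm s t) i))

  toℕ-stack : ∀ j → toℕ (stack j) ≡ toℕ j / t
  toℕ-stack = toℕ-quotient t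

  cellSymbol : Cell (s * t) → Fin (s * t)
  cellSymbol (i , j) = from columns (rowOffset i ⊕ stack j , band i ⊕ columnOffset j)

  alongRow : Fin (s * t) → Fin (s * t) ↔ Fin (s * t)
  alongRow i = ↔-sym columns ↔-∘ ((⊕ˡ-↔ (rowOffset i) ×-↔ ⊕ˡ-↔ (band i)) ↔-∘ columns)

  alongColumn : Fin (s * t) → Fin (s * t) ↔ Fin (s * t)
  alongColumn j = ↔-sym columns ↔-∘ ((⊕ʳ-↔ (stack j) ×-↔ ⊕ʳ-↔ (columnOffset j)) ↔-∘ (×-comm _ _ ↔-∘ rows))

  square : LatinSquare (s * t)
  square = record
    { entry    = cellSymbol
    ; rowLatin = λ i → ↔⇒∃! (alongRow i) (λ _ → refl)
    ; colLatin = λ j → ↔⇒∃! (alongColumn j) (λ _ → refl)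
    }

  square-realizes : (F : GerechteFramework (s * t)) → (∀ r → IsRectangle F r s t) → Realizes square F
  square-realizes F rectangle r = ↔⇒∃! withinRegion cellSymbol≗withinRegion
    where
    tiling : RectangularTiling (λ i j → region F (i , j)) (λ r → proj₁ (rectangle r)) (λ r → proj₁ (proj₂ (rectangle r))) s t
    tiling r = proj₂ (proj₂ (rectangle r))

    -- Any element of Fin (s * t), such as r itself, names a cell of r under regionSize.
    witness : RegionCells (region F) r
    witness = to (regionSize F r) r
    x = proj₁ (proj₁ witness)
    y = proj₂ (proj₁ witness)

    inBlock : ∀ i j → region F (i , j) ≡ r ⇔ (band i ≡ band x × stack j ≡ stack y)
    inBlock i j = (≡-via-toℕ band toℕ-band i x ×-⇔ ≡-via-toℕ stack toℕ-stack j y) ⇔-∘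
      subst (λ r′ → region F (i , j) ≡ r′ ⇔ (toℕ i / s ≡ toℕ x / s × toℕ j / t ≡ toℕ y / t))
            (proj₂ witness) (sameRegion⇔sameBlock tiling i j x y)

    withinRegion : RegionCells (region F) r ↔ Fin (s * t)
    withinRegion = ↔-sym columns ↔-∘ ((⊕ʳ-↔ (stack y) ×-↔ ⊕ˡ-↔ (band x)) ↔-∘ regionCells↔ (region F) r rows columns (band x) (stack y) inBlock)

    cellSymbol≗withinRegion : ∀ c → cellSymbol (proj₁ c) ≡ to withinRegion c
    cellSymbol≗withinRegion ((i , j) , e) =
      cong₂ (λ a c → from columns (rowOffset i ⊕ c , a ⊕ columnOffset j)) (proj₁ blocks) (proj₂ blocks)
      where blocks = Equivalence.to (inBlock i j) e

theorem5 : (s t : ℕ) → .{{_ : NonZero s}} → .{{_ : NonZero t}} →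
    (F : GerechteFramework (s * t)) →
    (∀ r → IsRectangle F r s t) →
    Realizable F
theorem5 s t F rectangle = square , square-realizes F rectangle
  where open BlockLatinSquare s t
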